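{- Let $M$ be a $3$-connected matroid. Let $(P_1,P_2,\ldots,P_m)$ be a partition of $E(M)$, where $m \geq 2$, such that $|P_1| \geq 2$ and, for all $i \in \{2,3,\ldots,m\}$ and $j \in \{1,\dots,m\}-\{i\}$, the set $P_i$ is a triad and $r(P_i \cup P_j) = r(P_j) + 1$. Then $(P_1,P_2,\ldots,P_m)$ is a paddle of $M$.
   Context: A triad is a 3-element cocircuit. $\lambda(X)=r(X)+r(E-X)-r(M)$ and $\sqcap(X,Y)=r(X)+r(Y)-r(X\cup Y)$. A partition $(P_1,\dots,P_m)$ of $E(M)$ is a paddle if $|P_i|\ge2$ for all $i$, $\lambda(\bigcup_{j\in J}P_j)\le2$ for every $J\subseteq\{1,\dots,m\}$, and $\sqcap(P_i,P_j)=2$ for all distinct $i,j$. -}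

module Defs where

open import Data.Nat using (ℕ; zero; suc; _+_; _∸_; _≤_; _<_)
open import Data.Fin using (Fin; toℕ)
open import Data.Fin.Subset using (Subset; ⊤; ∁; _∪_; _∩_; _⊆_; _⊂_; ∣_∣; ⋃)
open import Data.Fin.Subset.Properties using (_∈?_)
open import Data.List using (List; map; filter; allFin)
open import Data.Product using (_×_)
open import Relation.Nullary using (¬_)
open import Relation.Binary.PropositionalEquality using (_≡_)

record Matroid (n : ℕ) : Set where
  field
    r      : Subset n → ℕ
    r-card : ∀ X → r X ≤ ∣ X ∣
    r-mono : ∀ X Y → X ⊆ Y → r X ≤ r Y
    r-sub  : ∀ X Y → r (X ∪ Y) + r (X ∩ Y) ≤ r X + r Y
open Matroid public

module _ {n : ℕ} (M : Matroid n) where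

  rM : ℕ
  rM = r M ⊤

  -- connectivity function λ(X) = r(X) + r(E − X) − r(M)  (always ≥ 0)
  conn : Subset n → ℕ
  conn X = (r M X + r M (∁ X)) ∸ rM

  -- local connectivity ⊓(X,Y) = r(X) + r(Y) − r(X ∪ Y)  (always ≥ 0)
  sqcap : Subset n → Subset n → ℕ
  sqcap X Y = (r M X + r M Y) ∸ r M (X ∪ Y)

  IsSeparation : ℕ → Subset n → Set
  IsSeparation k X = (k ≤ ∣ X ∣) × (k ≤ ∣ ∁ X ∣) × (conn X < k)

  ThreeConnected : Set
  ThreeConnected = ∀ k → k < 3 → ∀ X → ¬ IsSeparation k X

  dualRank : Subset n → ℕ
  dualRank X = (∣ X ∣ + r M (∁ X)) ∸ rM

  DualIndependent : Subset n → Set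
  DualIndependent X = dualRank X ≡ ∣ X ∣

  Cocircuit : Subset n → Set
  Cocircuit C = (¬ DualIndependent C) × (∀ D → D ⊂ C → DualIndependent D)

  Triad : Subset n → Set
  Triad T = Cocircuit T × (∣ T ∣ ≡ 3)

open import Data.Fin.Subset using (_∈_)
open import Data.Product using (∃)

IsPartition : ∀ {n m} → (Fin m → Subset n) → Set
IsPartition {n} {m} P =
  (∀ (e : Fin n) → ∃ λ i → e ∈ P i) ×
  (∀ (e : Fin n) (i j : Fin m) → e ∈ P i → e ∈ P j → i ≡ j)

unionOver : ∀ {n m} → (Fin m → Subset n) → Subset m → Subset n
unionOver {n} {m} P J = ⋃ (map P (filter (_∈? J) (allFin m)))

IsPaddle : ∀ {n m} → Matroid n → (Fin m → Subset n) → Set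
IsPaddle {n} {m} M P =
  IsPartition P ×
  (∀ i → 2 ≤ ∣ P i ∣) ×
  (∀ (J : Subset m) → conn M (unionOver P J) ≤ 2) ×
  (∀ i j → ¬ (i ≡ j) → sqcap M (P i) (P j) ≡ 2)

{-# OPTIONS --safe #-}
-- A triad block Pᵢ (i ≠ 1) is a cocircuit, so r(E − Pᵢ) < r(M); by submodularity, adding Pᵢ
-- to any set disjoint from it raises the rank by at least one, and 3-connectivity forces
-- r(Pᵢ) = 3. Conversely, r(Pᵢ ∪ Pⱼ) = r(Pⱼ) + 1 and submodularity show that adding Pᵢ to a set
-- containing some other block raises the rank by at most one. So a union Y of k triad blocks
-- has r(Y) ≤ 2 + k and r(E − Y) + k ≤ r(M), whence λ(Y) ≤ 2; every union of blocks is such a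
-- Y or its complement. Finally ⊓(Pᵢ, Pⱼ) = 3 + r(Pⱼ) − (r(Pⱼ) + 1) = 2.
module Submission where

open import Defs

open import Algebra.Lattice.Properties.BooleanAlgebra using (¬-involutive)
open import Data.Empty using (⊥-elim)
open import Data.Fin using (Fin; zero; toℕ; _≟_)
open import Data.Fin.Properties using (toℕ-injective)
open import Data.Fin.Subset using (Subset; ⊤; ∁; _∪_; _∩_; _∈_; _∉_; _⊆_; ⋃; ∣_∣) renaming (⊥ to ∅)
open import Data.Fin.Subset.Properties
  using ( _∈?_; x∈p∪q⁺; x∈p∪q⁻; x∈p∩q⁺; x∈∁p⇒x∉p; x∉p⇒x∈∁p; x∈p⇒x∉∁p; p⊆q⇒∁p⊇∁q
        ; p⊆p∪q; q⊆p∪q; ⊆-refl; ⊆-trans; ⊆-antisym; ⊆⊤; p⊆q⇒∣p∣≤∣q∣; ∉⊥; ∣⊥∣≡0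
        ; p∪∁p≡⊤; ∪-inverseˡ; ∪-identityʳ; ∪-assoc; ∪-comm; ∪-∩-booleanAlgebra )
open import Data.List using ([]; _∷_; map; filter; allFin; length)
open import Data.List.Properties using (length-map)
open import Data.List.Membership.Propositional using () renaming (_∈_ to _∈ₗ_)
open import Data.List.Membership.Propositional.Properties
  using (∈-map⁺; ∈-map⁻; ∈-filter⁺; ∈-filter⁻; ∈-allFin)
open import Data.List.Relation.Unary.Any using (here; there)
open import Data.List.Relation.Unary.All using (All; []; _∷_)
import Data.List.Relation.Unary.All as All
import Data.List.Relation.Unary.All.Properties as All
open import Data.List.Relation.Unary.AllPairs using (AllPairs; []; _∷_)
import Data.List.Relation.Unary.AllPairs as AllPairs
import Data.List.Relation.Unary.AllPairs.Properties as AllPairs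
open import Data.List.Relation.Unary.Unique.Propositional using (Unique)
import Data.List.Relation.Unary.Unique.Propositional.Properties as Unique
open import Data.Nat using (ℕ; suc; _+_; _∸_; _≤_; _<_; z≤n; s≤s)
open import Data.Nat.Properties
  using ( +-comm; +-assoc; +-suc; +-identityʳ; +-mono-≤; +-monoˡ-≤; +-monoʳ-≤; +-cancelˡ-≤; +-cancelʳ-≤
        ; ≤-trans; ≤-reflexive; ≤-antisym; ≮⇒≥; m≤n⇒m<n∨m≡n; m≤m+n; m+n∸n≡m; m≤n+o⇒m∸n≤o; m≤o∸n⇒m+n≤o
        ; module ≤-Reasoning )
open import Data.Product using (∃; _×_; _,_; proj₁; proj₂; uncurry)
open import Data.Sum using (inj₁; inj₂; [_,_]′)
open import Function using (_∘_)
open import Relation.Nullary using (¬_; yes; no; contradiction)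
open import Relation.Binary.PropositionalEquality
  using (_≡_; _≢_; refl; sym; trans; cong; cong₂; subst; module ≡-Reasoning)

∪-lub : ∀ {n} {X Y Z : Subset n} → X ⊆ Z → Y ⊆ Z → X ∪ Y ⊆ Z
∪-lub {X = X} {Y} X⊆Z Y⊆Z x∈X∪Y = [ X⊆Z , Y⊆Z ]′ (x∈p∪q⁻ X Y x∈X∪Y)

∁-involutive : ∀ {n} (X : Subset n) → ∁ (∁ X) ≡ X
∁-involutive {n} = ¬-involutive (∪-∩-booleanAlgebra n)

⊆-⋃ : ∀ {n} {X : Subset n} {Xs} → X ∈ₗ Xs → X ⊆ ⋃ Xs
⊆-⋃ (here refl)   x∈X = x∈p∪q⁺ (inj₁ x∈X)
⊆-⋃ (there X∈Xs) x∈X = x∈p∪q⁺ (inj₂ (⊆-⋃ X∈Xs x∈X))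

x∈⋃⁻ : ∀ {n} {x : Fin n} Xs → x ∈ ⋃ Xs → ∃ λ X → X ∈ₗ Xs × x ∈ X
x∈⋃⁻ []       x∈∅ = ⊥-elim (∉⊥ x∈∅)
x∈⋃⁻ (X ∷ Xs) x∈⋃ with x∈p∪q⁻ X (⋃ Xs) x∈⋃
... | inj₁ x∈X   = X , here refl , x∈X
... | inj₂ x∈⋃Xs = let Y , Y∈Xs , x∈Y = x∈⋃⁻ Xs x∈⋃Xs in Y , there Y∈Xs , x∈Y

module _ {n m : ℕ} (P : Fin m → Subset n) where

  x∈unionOver⁺ : ∀ {J k x} → k ∈ J → x ∈ P k → x ∈ unionOver P J
  x∈unionOver⁺ {J} {k} k∈J = ⊆-⋃ (∈-map⁺ P (∈-filter⁺ (_∈? J) (∈-allFin k) k∈J))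

  x∈unionOver⁻ : ∀ J {x} → x ∈ unionOver P J → ∃ λ k → k ∈ J × x ∈ P k
  x∈unionOver⁻ J x∈U with x∈⋃⁻ (map P (filter (_∈? J) (allFin m))) x∈U
  ... | X , X∈ , x∈X with ∈-map⁻ P X∈
  ...   | k , k∈ , refl = k , proj₂ (∈-filter⁻ (_∈? J) {xs = allFin m} k∈) , x∈X

module _ {n m : ℕ} {P : Fin m → Subset n} (partition : IsPartition P) where

  blocks-disjoint : ∀ {i j} → i ≢ j → P i ⊆ ∁ (P j)
  blocks-disjoint i≢j x∈Pᵢ = x∉p⇒x∈∁p λ x∈Pⱼ → i≢j (proj₂ partition _ _ _ x∈Pᵢ x∈Pⱼ)

  ∁-unionOver : ∀ J → ∁ (unionOver P J) ≡ unionOver P (∁ J)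
  ∁-unionOver J = ⊆-antisym ∁U⊆U∁ U∁⊆∁U
    where
    ∁U⊆U∁ : ∁ (unionOver P J) ⊆ unionOver P (∁ J)
    ∁U⊆U∁ {x} x∉U = let k , x∈Pₖ = proj₁ partition x in
      x∈unionOver⁺ P (x∉p⇒x∈∁p λ k∈J → x∈∁p⇒x∉p x∉U (x∈unionOver⁺ P k∈J x∈Pₖ)) x∈Pₖ
    U∁⊆∁U : unionOver P (∁ J) ⊆ ∁ (unionOver P J)
    U∁⊆∁U {x} x∈U∁ = x∉p⇒x∈∁p λ x∈U →
      let k , k∈∁J , x∈Pₖ = x∈unionOver⁻ P (∁ J) x∈U∁
          l , l∈J  , x∈Pₗ = x∈unionOver⁻ P J x∈U
      in x∈∁p⇒x∉p k∈∁J (subst (_∈ J) (proj₂ partition x l k x∈Pₗ x∈Pₖ) l∈J)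

module _ {n : ℕ} (M : Matroid n) where

  r-∪-increment-antitone : ∀ {X Y Z} → Y ⊆ Z → r M (Z ∪ X) + r M Y ≤ r M Z + r M (Y ∪ X)
  r-∪-increment-antitone {X} {Y} {Z} Y⊆Z = begin
    r M (Z ∪ X) + r M Y                   ≤⟨ +-mono-≤ (r-mono M _ _ Z∪X⊆) (r-mono M _ _ Y⊆) ⟩
    r M ((Y ∪ X) ∪ Z) + r M ((Y ∪ X) ∩ Z) ≤⟨ r-sub M (Y ∪ X) Z ⟩
    r M (Y ∪ X) + r M Z                   ≡⟨ +-comm (r M (Y ∪ X)) (r M Z) ⟩
    r M Z + r M (Y ∪ X)                   ∎
    where
    open ≤-Reasoning
    Z∪X⊆ : Z ∪ X ⊆ (Y ∪ X) ∪ Z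
    Z∪X⊆ = ∪-lub (q⊆p∪q (Y ∪ X) Z) (p⊆p∪q Z ∘ q⊆p∪q Y X)
    Y⊆ : Y ⊆ (Y ∪ X) ∩ Z
    Y⊆ y∈Y = x∈p∩q⁺ (p⊆p∪q X y∈Y , Y⊆Z y∈Y)

  r-∪-≤-suc : ∀ {X Y Z} → Y ⊆ Z → r M (Y ∪ X) ≤ suc (r M Y) → r M (Z ∪ X) ≤ suc (r M Z)
  r-∪-≤-suc {X} {Y} {Z} Y⊆Z r[Y∪X]≤ = +-cancelʳ-≤ (r M Y) _ _ (begin
    r M (Z ∪ X) + r M Y   ≤⟨ r-∪-increment-antitone Y⊆Z ⟩
    r M Z + r M (Y ∪ X)   ≤⟨ +-monoʳ-≤ (r M Z) r[Y∪X]≤ ⟩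
    r M Z + suc (r M Y)   ≡⟨ +-suc (r M Z) (r M Y) ⟩
    suc (r M Z) + r M Y   ∎)
    where open ≤-Reasoning

  r-∪-≥-suc : ∀ {X Z} → Z ⊆ ∁ X → r M (∁ X) < rM M → suc (r M Z) ≤ r M (Z ∪ X)
  r-∪-≥-suc {X} {Z} Z⊆∁X r∁X<rM = +-cancelˡ-≤ (r M (∁ X)) _ _ (begin
    r M (∁ X) + suc (r M Z)  ≡⟨ +-suc (r M (∁ X)) (r M Z) ⟩
    suc (r M (∁ X)) + r M Z  ≤⟨ +-monoˡ-≤ (r M Z) r∁X<rM ⟩
    rM M + r M Z             ≡⟨ cong (λ E → r M E + r M Z) (sym (∪-inverseˡ X)) ⟩
    r M (∁ X ∪ X) + r M Z    ≤⟨ r-∪-increment-antitone Z⊆∁X ⟩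
    r M (∁ X) + r M (Z ∪ X)  ∎)
    where open ≤-Reasoning

  r-∪-⋃-≤ : ∀ {Y Z} Xs → Y ⊆ Z → All (λ X → r M (Y ∪ X) ≤ suc (r M Y)) Xs →
            r M (Z ∪ ⋃ Xs) ≤ r M Z + length Xs
  r-∪-⋃-≤ {Z = Z} [] _ _ = begin
    r M (Z ∪ ∅)  ≡⟨ cong (r M) (∪-identityʳ Z) ⟩
    r M Z        ≤⟨ m≤m+n (r M Z) 0 ⟩
    r M Z + 0    ∎
    where open ≤-Reasoning
  r-∪-⋃-≤ {Y} {Z} (X ∷ Xs) Y⊆Z (r[Y∪X]≤ ∷ r[Y∪Xs]≤) = begin
    r M (Z ∪ (X ∪ ⋃ Xs))     ≡⟨ cong (r M) (sym (∪-assoc Z X (⋃ Xs))) ⟩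
    r M ((Z ∪ X) ∪ ⋃ Xs)     ≤⟨ r-∪-⋃-≤ Xs (⊆-trans Y⊆Z (p⊆p∪q X)) r[Y∪Xs]≤ ⟩
    r M (Z ∪ X) + length Xs  ≤⟨ +-monoˡ-≤ (length Xs) (r-∪-≤-suc Y⊆Z r[Y∪X]≤) ⟩
    suc (r M Z) + length Xs  ≡⟨ sym (+-suc (r M Z) (length Xs)) ⟩
    r M Z + length (X ∷ Xs)  ∎
    where open ≤-Reasoning

  r-∪-⋃-≥ : ∀ {Z} Xs → All (λ X → Z ⊆ ∁ X) Xs → AllPairs (λ X X′ → X ⊆ ∁ X′) Xs →
            All (λ X → r M (∁ X) < rM M) Xs → r M Z + length Xs ≤ r M (Z ∪ ⋃ Xs)
  r-∪-⋃-≥ {Z} [] _ _ _ = begin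
    r M Z + 0    ≡⟨ +-identityʳ (r M Z) ⟩
    r M Z        ≡⟨ cong (r M) (sym (∪-identityʳ Z)) ⟩
    r M (Z ∪ ∅)  ∎
    where open ≤-Reasoning
  r-∪-⋃-≥ {Z} (X ∷ Xs) (Z⊆∁X ∷ Z⊆∁Xs) (X⊆∁Xs ∷ disjoint) (r∁X< ∷ r∁Xs<) = begin
    r M Z + length (X ∷ Xs)  ≡⟨ +-suc (r M Z) (length Xs) ⟩
    suc (r M Z) + length Xs  ≤⟨ +-monoˡ-≤ (length Xs) (r-∪-≥-suc Z⊆∁X r∁X<) ⟩
    r M (Z ∪ X) + length Xs  ≤⟨ r-∪-⋃-≥ Xs Z∪X⊆∁Xs disjoint r∁Xs< ⟩
    r M ((Z ∪ X) ∪ ⋃ Xs)     ≡⟨ cong (r M) (∪-assoc Z X (⋃ Xs)) ⟩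
    r M (Z ∪ (X ∪ ⋃ Xs))     ∎
    where
    open ≤-Reasoning
    Z∪X⊆∁Xs : All (λ X′ → Z ∪ X ⊆ ∁ X′) Xs
    Z∪X⊆∁Xs = All.zipWith (λ {X′} → uncurry (∪-lub {Z = ∁ X′})) (Z⊆∁Xs , X⊆∁Xs)

  rM≤r+r∁ : ∀ X → rM M ≤ r M X + r M (∁ X)
  rM≤r+r∁ X = begin
    rM M                               ≡⟨ cong (r M) (sym (p∪∁p≡⊤ X)) ⟩
    r M (X ∪ ∁ X)                      ≤⟨ m≤m+n (r M (X ∪ ∁ X)) _ ⟩
    r M (X ∪ ∁ X) + r M (X ∩ ∁ X)      ≤⟨ r-sub M X (∁ X) ⟩
    r M X + r M (∁ X)                  ∎
    where open ≤-Reasoning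

  3-connected⇒2+rM≤r+r∁ : ThreeConnected M → ∀ {X} → 2 ≤ ∣ X ∣ → 2 ≤ ∣ ∁ X ∣ →
                          2 + rM M ≤ r M X + r M (∁ X)
  3-connected⇒2+rM≤r+r∁ M3 {X} 2≤∣X∣ 2≤∣∁X∣ = m≤o∸n⇒m+n≤o 2 (rM≤r+r∁ X) 2≤conn
    where
    2≤conn : 2 ≤ conn M X
    2≤conn = ≮⇒≥ λ conn<2 → M3 2 (s≤s (s≤s (s≤s z≤n))) X (2≤∣X∣ , 2≤∣∁X∣ , conn<2)

  ¬coindependent⇒r∁<rM : ∀ {X} → ¬ DualIndependent M X → r M (∁ X) < rM M
  ¬coindependent⇒r∁<rM {X} ¬ind with m≤n⇒m<n∨m≡n (r-mono M (∁ X) ⊤ ⊆⊤)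
  ... | inj₁ r∁X<rM = r∁X<rM
  ... | inj₂ r∁X≡rM = contradiction X-coindependent ¬ind
    where
    X-coindependent : DualIndependent M X
    X-coindependent = trans (cong (λ k → (∣ X ∣ + k) ∸ rM M) r∁X≡rM) (m+n∸n≡m ∣ X ∣ (rM M))

  triad⇒r≡3 : ThreeConnected M → ∀ {T} → Triad M T → 2 ≤ ∣ ∁ T ∣ → r M T ≡ 3
  triad⇒r≡3 M3 {T} ((¬ind , _) , ∣T∣≡3) 2≤∣∁T∣ =
    ≤-antisym (subst (r M T ≤_) ∣T∣≡3 (r-card M T)) (+-cancelʳ-≤ (r M (∁ T)) 3 (r M T) (begin
      3 + r M (∁ T)       ≤⟨ +-monoʳ-≤ 2 (¬coindependent⇒r∁<rM ¬ind) ⟩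
      2 + rM M            ≤⟨ 3-connected⇒2+rM≤r+r∁ M3 2≤∣T∣ 2≤∣∁T∣ ⟩
      r M T + r M (∁ T)   ∎))
    where
    open ≤-Reasoning
    2≤∣T∣ : 2 ≤ ∣ T ∣
    2≤∣T∣ = subst (2 ≤_) (sym ∣T∣≡3) (s≤s (s≤s z≤n))

  conn-∁ : ∀ X → conn M (∁ X) ≡ conn M X
  conn-∁ X = cong (_∸ rM M) (begin
    r M (∁ X) + r M (∁ (∁ X))  ≡⟨ cong (λ Y → r M (∁ X) + r M Y) (∁-involutive X) ⟩
    r M (∁ X) + r M X          ≡⟨ +-comm (r M (∁ X)) (r M X) ⟩
    r M X + r M (∁ X)          ∎)
    where open ≡-Reasoning

  sqcap-comm : ∀ X Y → sqcap M X Y ≡ sqcap M Y X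
  sqcap-comm X Y = cong₂ _∸_ (+-comm (r M X) (r M Y)) (cong (r M) (∪-comm X Y))

  sqcap≡2 : ∀ {X Y} → r M X ≡ 3 → r M (X ∪ Y) ≡ r M Y + 1 → sqcap M X Y ≡ 2
  sqcap≡2 {X} {Y} r[X]≡3 r[X∪Y]≡ = begin
    (r M X + r M Y) ∸ r M (X ∪ Y)  ≡⟨ cong₂ _∸_ (cong (_+ r M Y) r[X]≡3) r[X∪Y]≡ ⟩
    (3 + r M Y) ∸ (r M Y + 1)      ≡⟨ cong ((3 + r M Y) ∸_) (+-comm (r M Y) 1) ⟩
    (2 + suc (r M Y)) ∸ suc (r M Y) ≡⟨ m+n∸n≡m 2 (suc (r M Y)) ⟩
    2                              ∎
    where open ≡-Reasoning

module _ {n m : ℕ} (M : Matroid n) (M3 : ThreeConnected M)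
         {P : Fin m → Subset n} (partition : IsPartition P)
         (o : Fin m) (2≤∣Pₒ∣ : 2 ≤ ∣ P o ∣)
         (triad : ∀ i → i ≢ o → Triad M (P i))
         (r[Pᵢ∪Pⱼ]≡ : ∀ i j → i ≢ o → i ≢ j → r M (P i ∪ P j) ≡ r M (P j) + 1) where

  r[∁Pᵢ]<rM : ∀ {i} → i ≢ o → r M (∁ (P i)) < rM M
  r[∁Pᵢ]<rM i≢o = ¬coindependent⇒r∁<rM M (proj₁ (proj₁ (triad _ i≢o)))

  r[Pᵢ]≡3 : ∀ {i} → i ≢ o → r M (P i) ≡ 3
  r[Pᵢ]≡3 i≢o = triad⇒r≡3 M M3 (triad _ i≢o)
    (≤-trans 2≤∣Pₒ∣ (p⊆q⇒∣p∣≤∣q∣ (blocks-disjoint partition (i≢o ∘ sym))))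

  r[Pᵢ∪Pₖ]≤suc : ∀ {i k} → k ≢ o → i ≢ k → r M (P i ∪ P k) ≤ suc (r M (P i))
  r[Pᵢ∪Pₖ]≤suc {i} {k} k≢o i≢k = ≤-reflexive (begin
    r M (P i ∪ P k)  ≡⟨ cong (r M) (∪-comm (P i) (P k)) ⟩
    r M (P k ∪ P i)  ≡⟨ r[Pᵢ∪Pⱼ]≡ k i k≢o (i≢k ∘ sym) ⟩
    r M (P i) + 1    ≡⟨ +-comm (r M (P i)) 1 ⟩
    suc (r M (P i))  ∎)
    where open ≡-Reasoning

  r-⋃-blocks≤ : ∀ C → All (_≢ o) C → Unique C → r M (⋃ (map P C)) ≤ 2 + length C
  r-⋃-blocks≤ [] _ _ = ≤-trans (r-card M ∅) (≤-trans (≤-reflexive (∣⊥∣≡0 n)) z≤n)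
  r-⋃-blocks≤ (i ∷ C) (i≢o ∷ C≢o) (i∉C ∷ _) = begin
    r M (P i ∪ ⋃ (map P C))       ≤⟨ r-∪-⋃-≤ M (map P C) ⊆-refl r[Pᵢ∪C]≤suc ⟩
    r M (P i) + length (map P C)  ≡⟨ cong₂ _+_ (r[Pᵢ]≡3 i≢o) (length-map P C) ⟩
    3 + length C                  ∎
    where
    open ≤-Reasoning
    r[Pᵢ∪C]≤suc : All (λ X → r M (P i ∪ X) ≤ suc (r M (P i))) (map P C)
    r[Pᵢ∪C]≤suc = All.map⁺ (All.zipWith (uncurry r[Pᵢ∪Pₖ]≤suc) (C≢o , i∉C))

  conn-⋃-blocks≤2 : ∀ C → All (_≢ o) C → Unique C → conn M (⋃ (map P C)) ≤ 2
  conn-⋃-blocks≤2 C C≢o unique = m≤n+o⇒m∸n≤o _ (rM M) (begin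
    r M Y + r M (∁ Y)             ≤⟨ +-monoˡ-≤ (r M (∁ Y)) (r-⋃-blocks≤ C C≢o unique) ⟩
    2 + length C + r M (∁ Y)      ≡⟨ +-assoc 2 (length C) (r M (∁ Y)) ⟩
    2 + (length C + r M (∁ Y))    ≡⟨ cong (2 +_) (+-comm (length C) (r M (∁ Y))) ⟩
    2 + (r M (∁ Y) + length C)    ≤⟨ +-monoʳ-≤ 2 r[∁Y]+∣C∣≤rM ⟩
    2 + rM M                      ≡⟨ +-comm 2 (rM M) ⟩
    rM M + 2                      ∎)
    where
    open ≤-Reasoning
    Y : Subset n
    Y = ⋃ (map P C)
    r[∁Y]+∣C∣≤rM : r M (∁ Y) + length C ≤ rM M
    r[∁Y]+∣C∣≤rM = begin
      r M (∁ Y) + length C          ≡⟨ cong (r M (∁ Y) +_) (sym (length-map P C)) ⟩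
      r M (∁ Y) + length (map P C)  ≤⟨ r-∪-⋃-≥ M (map P C)
                                         (All.tabulate (p⊆q⇒∁p⊇∁q ∘ ⊆-⋃))
                                         (AllPairs.map⁺ (AllPairs.map (blocks-disjoint partition) unique))
                                         (All.map⁺ (All.map r[∁Pᵢ]<rM C≢o)) ⟩
      r M (∁ Y ∪ Y)                 ≤⟨ r-mono M _ ⊤ ⊆⊤ ⟩
      rM M                          ∎

  o∉J⇒conn-unionOver≤2 : ∀ {J} → o ∉ J → conn M (unionOver P J) ≤ 2
  o∉J⇒conn-unionOver≤2 {J} o∉J = conn-⋃-blocks≤2 (filter (_∈? J) (allFin m))
    (All.tabulate λ k∈ k≡o → o∉J (subst (_∈ J) k≡o (proj₂ (∈-filter⁻ (_∈? J) {xs = allFin m} k∈))))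
    (Unique.filter⁺ (_∈? J) (Unique.allFin⁺ m))

  conn-unionOver≤2 : ∀ J → conn M (unionOver P J) ≤ 2
  conn-unionOver≤2 J with o ∈? J
  ... | no o∉J = o∉J⇒conn-unionOver≤2 o∉J
  ... | yes o∈J = begin
    conn M (unionOver P J)      ≡⟨ sym (conn-∁ M (unionOver P J)) ⟩
    conn M (∁ (unionOver P J))  ≡⟨ cong (conn M) (∁-unionOver partition J) ⟩
    conn M (unionOver P (∁ J))  ≤⟨ o∉J⇒conn-unionOver≤2 (x∈p⇒x∉∁p o∈J) ⟩
    2                           ∎
    where open ≤-Reasoning

  2≤∣Pᵢ∣ : ∀ i → 2 ≤ ∣ P i ∣
  2≤∣Pᵢ∣ i with i ≟ o
  ... | yes refl = 2≤∣Pₒ∣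
  ... | no i≢o   = subst (2 ≤_) (sym (proj₂ (triad i i≢o))) (s≤s (s≤s z≤n))

  sqcap-blocks≡2 : ∀ i j → i ≢ j → sqcap M (P i) (P j) ≡ 2
  sqcap-blocks≡2 i j i≢j with i ≟ o
  ... | no i≢o   = sqcap≡2 M (r[Pᵢ]≡3 i≢o) (r[Pᵢ∪Pⱼ]≡ i j i≢o i≢j)
  ... | yes refl = trans (sqcap-comm M (P o) (P j)) (sqcap≡2 M (r[Pᵢ]≡3 j≢o) (r[Pᵢ∪Pⱼ]≡ j o j≢o j≢o))
    where
    j≢o : j ≢ o
    j≢o = i≢j ∘ sym

  isPaddle : IsPaddle M P
  isPaddle = partition , 2≤∣Pᵢ∣ , conn-unionOver≤2 , sqcap-blocks≡2

lemma5p18 : ∀ {n : ℕ} (M : Matroid n) → ThreeConnected M →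
    (m : ℕ) → 2 ≤ m → (P : Fin m → Subset n) → IsPartition P →
    (∀ i → toℕ i ≡ 0 → 2 ≤ ∣ P i ∣) →
    (∀ i → ¬ (toℕ i ≡ 0) → Triad M (P i)) →
    (∀ i j → ¬ (toℕ i ≡ 0) → ¬ (i ≡ j) → r M (P i ∪ P j) ≡ r M (P j) + 1) →
    IsPaddle M P
lemma5p18 _ _ 0 () _ _ _ _ _
lemma5p18 M M3 (suc _) _ P partition 2≤∣P₁∣ triad r[Pᵢ∪Pⱼ]≡ =
  isPaddle M M3 partition zero (2≤∣P₁∣ zero refl)
    (λ i i≢0 → triad i (i≢0 ∘ toℕ-injective))
    (λ i j i≢0 → r[Pᵢ∪Pⱼ]≡ i j (i≢0 ∘ toℕ-injective))
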